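{- Let $n\ge 2$ and $1\leq g\leq n-1$. If $X$ is a subgraph of the $n$-dimensional hierarchical cubic network $HCN_{n}$ with minimum degree $\delta(X)\geq g$, then $|V(X)|\geq 2^{g}$.
   Context: For $n\ge 1$ let $V_n=\{0,1\}^n$; for $x\in V_n$, $\overline{x}$ denotes its bitwise complement. $HCN_n$ has vertex set $V_n\times V_n$. For each $x\in V_n$, the vertices $\{(x,y):y\in V_n\}$ induce a copy $xQ_n$ of the $n$-dimensional hypercube ($(x,y)\sim(x,y')$ iff $y,y'$ differ in exactly one bit). In addition, each vertex $(x,y)$ is joined to $(y,x)$ if $x\neq y$, and to $(\overline{x},\overline{y})$ if $x=y$. These are all the edges. -}

module Defs where

open import Data.Bool using (Bool; not)
import Data.Bool.Properties as BoolP
open import Data.Nat using (ℕ)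
open import Data.Fin using (Fin)
open import Data.Vec using (Vec; map; _[_]%=_)
import Data.Vec.Properties as VecP
import Relation.Nullary
import Data.Nat
open import Data.Product using (_×_; _,_; ∃-syntax)
import Data.Product.Properties as ProdP
open import Data.Sum using (_⊎_)
open import Data.List using (List; filter; length)
open import Data.List.Membership.Propositional using (_∈_)
open import Data.List.Relation.Unary.Unique.Propositional using (Unique)
open import Data.List.Membership.DecPropositional using () renaming (_∈?_ to mem?)
open import Relation.Binary.PropositionalEquality using (_≡_)
open import Relation.Binary.Definitions using (DecidableEquality)
open import Relation.Nullary using (¬_)
open import Relation.Nullary.Decidable using (_⊎-dec_)

Word : ℕ → Set
Word n = Vec Bool n

_≟W_ : ∀ {n} → DecidableEquality (Word n)
_≟W_ = VecP.≡-dec BoolP._≟_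

compl : ∀ {n} → Word n → Word n
compl = map not

flipBit : ∀ {n} → Fin n → Word n → Word n
flipBit i y = y [ i ]%= not

Vertex : ℕ → Set
Vertex n = Word n × Word n

_≟V_ : ∀ {n} → DecidableEquality (Vertex n)
_≟V_ = ProdP.≡-dec _≟W_ _≟W_

HCNAdj : ∀ {n} → Vertex n → Vertex n → Set
HCNAdj (x , y) (x' , y') =
    -- cube edge inside xQ_n : y, y' differ in exactly one bit
    (x' ≡ x × ∃[ i ] (y' ≡ flipBit i y))
  ⊎
    (¬ (x ≡ y) × x' ≡ y × y' ≡ x)
  ⊎
    (x ≡ y × x' ≡ compl x × y' ≡ compl y)

-- A (finite) subgraph X of HCN_n: a duplicate-free list of vertices and a
-- list of edges (each an unordered pair, stored as an ordered pair),
-- every edge being an edge of HCN_n between vertices of X.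
record Subgraph (n : ℕ) : Set where
  field
    verts     : List (Vertex n)
    verts-nodup : Unique verts
    edges     : List (Vertex n × Vertex n)
    edge-adj  : ∀ {u v} → (u , v) ∈ edges → HCNAdj u v
    edge-vs   : ∀ {u v} → (u , v) ∈ edges → u ∈ verts × v ∈ verts

module _ {n : ℕ} (X : Subgraph n) where
  open Subgraph X

  EdgeX : Vertex n → Vertex n → Set
  EdgeX u v = (u , v) ∈ edges ⊎ (v , u) ∈ edges

  EdgeX? : ∀ u v → Relation.Nullary.Dec (EdgeX u v)
  EdgeX? u v = mem? (ProdP.≡-dec _≟V_ _≟V_) (u , v) edges
         ⊎-dec mem? (ProdP.≡-dec _≟V_ _≟V_) (v , u) edges

  degX : Vertex n → ℕ
  degX u = length (filter (EdgeX? u) verts)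

  orderX : ℕ
  orderX = length verts

  MinDegreeAtLeast : ℕ → Set
  MinDegreeAtLeast g = ∀ {u} → u ∈ verts → g Data.Nat.≤ degX u

-- Every vertex (x , y) of HCN_n has exactly one neighbour outside its cluster xQ_n, its
-- external neighbour.  If X lies inside one cluster, it is a subgraph of Q_n of minimum degree
-- at least g, and such a subgraph has at least 2^g vertices: split Q_n into two copies of
-- Q_(n-1); either X lies in one of them, or each half of X has minimum degree at least g - 1.
-- If X meets two clusters, then within each of them X has minimum degree at least g - 1, so
-- each contains 2^(g-1) vertices of X.
module Submission where

open import Defs
open import Data.Nat using (ℕ; zero; suc; _+_; _^_; _∸_; _≤_; z≤n; s≤s; s≤s⁻¹; _≟_)
open import Data.Nat.Properties
open import Algebra.Properties.CommutativeSemigroup +-commutativeSemigroup using (interchange)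
open import Data.Bool using (Bool; true; false; not; _∧_; T)
open import Data.Bool.Properties using (not-involutive; T-∧)
open import Function.Bundles using (Equivalence)
open Equivalence using (from)
open import Data.Fin using (Fin) renaming (zero to fzero; suc to fsuc)
open import Data.Vec using ([]; _∷_; lookup; map)
open import Data.Vec.Properties
  using (∷-injectiveʳ; map-∘; map-cong; map-id; updateAt-updateAt-local; updateAt-id)
open import Data.Product using (_×_; _,_; ∃-syntax; proj₁; proj₂)
open import Data.Sum using (_⊎_; inj₁; inj₂; [_,_])
open import Data.Unit using (tt)
open import Function using (_∘_; id)
open import Data.List using (List; []; _∷_; length; filter)
open import Data.List.Relation.Unary.Any using (here; there)
open import Data.List.Relation.Unary.All using (All; all?)
import Data.List.Relation.Unary.All as All
open import Data.List.Relation.Unary.All.Properties using (All¬⇒¬Any; ¬All⇒Any¬)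
open import Data.List.Relation.Unary.AllPairs using ([]; _∷_)
open import Data.List.Membership.Propositional using (_∈_; find)
open import Data.List.Membership.Propositional.Properties using (∈-filter⁻)
open import Data.List.Relation.Unary.Unique.Propositional using (Unique)
open import Data.List.Relation.Unary.Unique.Propositional.Properties using (filter⁺)
open import Data.List.Membership.DecPropositional using () renaming (_∈?_ to mem?)
open import Relation.Binary.PropositionalEquality hiding ([_])
open import Relation.Nullary using (¬_; Dec; yes; no; does; contradiction)
open import Relation.Nullary.Decidable using (dec-true; dec-false)

⟦_⟧ : Bool → ℕ
⟦ true ⟧  = 1
⟦ false ⟧ = 0

T⇒1≤⟦⟧ : ∀ {b} → T b → 1 ≤ ⟦ b ⟧
T⇒1≤⟦⟧ {true} _ = ≤-refl

1≤⟦⟧⇒T : ∀ {b} → 1 ≤ ⟦ b ⟧ → T b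
1≤⟦⟧⇒T {true} _ = tt

suc≤⟦⟧+⇒≤ : ∀ b {g m} → suc g ≤ ⟦ b ⟧ + m → g ≤ m
suc≤⟦⟧+⇒≤ false p = ≤-trans (n≤1+n _) p
suc≤⟦⟧+⇒≤ true  p = s≤s⁻¹ p

T-does⁺ : ∀ {A : Set} (d : Dec A) → A → T (does d)
T-does⁺ (yes _) _ = tt
T-does⁺ (no ¬a) a = contradiction a ¬a

T-does⁻ : ∀ {A : Set} (d : Dec A) → T (does d) → A
T-does⁻ (yes a) _ = a

2^[1+g]≤+ : ∀ g {a b} → 2 ^ g ≤ a → 2 ^ g ≤ b → 2 ^ suc g ≤ a + b
2^[1+g]≤+ g p q = +-mono-≤ p (≤-trans (≤-reflexive (+-identityʳ (2 ^ g))) q)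

-- Sums over words and vertices

sumW : ∀ {n} → (Word n → ℕ) → ℕ
sumW {zero}  h = h []
sumW {suc n} h = sumW (h ∘ (false ∷_)) + sumW (h ∘ (true ∷_))

sumW-mono-≤ : ∀ {n} {h k : Word n → ℕ} → (∀ y → h y ≤ k y) → sumW h ≤ sumW k
sumW-mono-≤ {zero}  p = p []
sumW-mono-≤ {suc n} p = +-mono-≤ (sumW-mono-≤ (p ∘ (false ∷_))) (sumW-mono-≤ (p ∘ (true ∷_)))

sumW-cong : ∀ {n} {h k : Word n → ℕ} → (∀ y → h y ≡ k y) → sumW h ≡ sumW k
sumW-cong {zero}  p = p []
sumW-cong {suc n} p = cong₂ _+_ (sumW-cong (p ∘ (false ∷_))) (sumW-cong (p ∘ (true ∷_)))

sumW-distrib-+ : ∀ {n} (h k : Word n → ℕ) → sumW (λ y → h y + k y) ≡ sumW h + sumW k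
sumW-distrib-+ {zero}  h k = refl
sumW-distrib-+ {suc n} h k = begin
  sumW (λ y → h₀ y + k₀ y) + sumW (λ y → h₁ y + k₁ y)
    ≡⟨ cong₂ _+_ (sumW-distrib-+ h₀ k₀) (sumW-distrib-+ h₁ k₁) ⟩
  (sumW h₀ + sumW k₀) + (sumW h₁ + sumW k₁)
    ≡⟨ interchange (sumW h₀) (sumW k₀) (sumW h₁) (sumW k₁) ⟩
  sumW h + sumW k ∎
  where
  open ≡-Reasoning
  h₀ h₁ k₀ k₁ : Word n → ℕ
  h₀ = h ∘ (false ∷_)
  h₁ = h ∘ (true ∷_)
  k₀ = k ∘ (false ∷_)
  k₁ = k ∘ (true ∷_)

sumW-zero : ∀ {n} {h : Word n → ℕ} → (∀ y → h y ≡ 0) → sumW h ≡ 0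
sumW-zero {zero}  p = p []
sumW-zero {suc n} p = cong₂ _+_ (sumW-zero (p ∘ (false ∷_))) (sumW-zero (p ∘ (true ∷_)))

sumW-at : ∀ {n} {h : Word n → ℕ} (a : Word n) → (∀ y → y ≢ a → h y ≡ 0) → sumW h ≡ h a
sumW-at {zero} [] _ = refl
sumW-at {suc n} {h} (false ∷ a) p = begin
  sumW (h ∘ (false ∷_)) + sumW (h ∘ (true ∷_))
    ≡⟨ cong₂ _+_ (sumW-at a (λ y y≢a → p (false ∷ y) (y≢a ∘ ∷-injectiveʳ)))
                 (sumW-zero (λ y → p (true ∷ y) (λ ()))) ⟩
  h (false ∷ a) + 0
    ≡⟨ +-identityʳ _ ⟩
  h (false ∷ a) ∎
  where open ≡-Reasoning
sumW-at {suc n} {h} (true ∷ a) p =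
  cong₂ _+_ (sumW-zero (λ y → p (false ∷ y) (λ ())))
            (sumW-at a (λ y y≢a → p (true ∷ y) (y≢a ∘ ∷-injectiveʳ)))

term≤sumW : ∀ {n} (h : Word n → ℕ) (a : Word n) → h a ≤ sumW h
term≤sumW {zero}  h []          = ≤-refl
term≤sumW {suc n} h (false ∷ a) = ≤-trans (term≤sumW (h ∘ (false ∷_)) a) (m≤m+n _ _)
term≤sumW {suc n} h (true ∷ a)  = ≤-trans (term≤sumW (h ∘ (true ∷_)) a) (m≤n+m _ _)

term+term≤sumW : ∀ {n} (h : Word n → ℕ) {a b : Word n} → a ≢ b → h a + h b ≤ sumW h
term+term≤sumW {zero} h {[]} {[]} a≢b = contradiction refl a≢b
term+term≤sumW {suc n} h {false ∷ a} {false ∷ b} a≢b =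
  ≤-trans (term+term≤sumW (h ∘ (false ∷_)) (a≢b ∘ cong (false ∷_))) (m≤m+n _ _)
term+term≤sumW {suc n} h {true ∷ a} {true ∷ b} a≢b =
  ≤-trans (term+term≤sumW (h ∘ (true ∷_)) (a≢b ∘ cong (true ∷_))) (m≤n+m _ _)
term+term≤sumW {suc n} h {false ∷ a} {true ∷ b} _ =
  +-mono-≤ (term≤sumW (h ∘ (false ∷_)) a) (term≤sumW (h ∘ (true ∷_)) b)
term+term≤sumW {suc n} h {true ∷ a} {false ∷ b} _ =
  ≤-trans (≤-reflexive (+-comm (h (true ∷ a)) _))
          (+-mono-≤ (term≤sumW (h ∘ (false ∷_)) b) (term≤sumW (h ∘ (true ∷_)) a))

sumV : ∀ {n} → (Vertex n → ℕ) → ℕ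
sumV h = sumW (λ x → sumW (λ y → h (x , y)))

sumV-mono-≤ : ∀ {n} {h k : Vertex n → ℕ} → (∀ v → h v ≤ k v) → sumV h ≤ sumV k
sumV-mono-≤ p = sumW-mono-≤ (λ x → sumW-mono-≤ (λ y → p (x , y)))

sumV-cong : ∀ {n} {h k : Vertex n → ℕ} → (∀ v → h v ≡ k v) → sumV h ≡ sumV k
sumV-cong p = sumW-cong (λ x → sumW-cong (λ y → p (x , y)))

sumV-distrib-+ : ∀ {n} (h k : Vertex n → ℕ) → sumV (λ v → h v + k v) ≡ sumV h + sumV k
sumV-distrib-+ h k =
  trans (sumW-cong (λ x → sumW-distrib-+ (λ y → h (x , y)) (λ y → k (x , y))))
        (sumW-distrib-+ (λ x → sumW (λ y → h (x , y))) (λ x → sumW (λ y → k (x , y))))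

sumV-zero : ∀ {n} {h : Vertex n → ℕ} → (∀ v → h v ≡ 0) → sumV h ≡ 0
sumV-zero p = sumW-zero (λ x → sumW-zero (λ y → p (x , y)))

sumV-within : ∀ {n} {h : Vertex n → ℕ} (x : Word n) → (∀ x' y → x' ≢ x → h (x' , y) ≡ 0) →
  sumV h ≡ sumW (λ y → h (x , y))
sumV-within x p = sumW-at x (λ x' x'≢x → sumW-zero (λ y → p x' y x'≢x))

sumV-at : ∀ {n} {h : Vertex n → ℕ} (a : Vertex n) → (∀ v → v ≢ a → h v ≡ 0) → sumV h ≡ h a
sumV-at (x , y) p = trans (sumV-within x (λ x' y' x'≢x → p (x' , y') (x'≢x ∘ cong proj₁)))
                          (sumW-at y (λ y' y'≢y → p (x , y') (y'≢y ∘ cong proj₂)))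

sumW-≟∧ : ∀ {n} (y : Word n) (S : Word n → Bool) →
  sumW (λ y' → ⟦ does (y ≟W y') ∧ S y' ⟧) ≡ ⟦ S y ⟧
sumW-≟∧ y S = trans (sumW-at y off-y) (cong (λ b → ⟦ b ∧ S y ⟧) (dec-true (y ≟W y) refl))
  where
  off-y : ∀ y' → y' ≢ y → ⟦ does (y ≟W y') ∧ S y' ⟧ ≡ 0
  off-y y' y'≢y = cong (λ b → ⟦ b ∧ S y' ⟧) (dec-false (y ≟W y') (y'≢y ∘ sym))

sumV-≟∧ : ∀ {n} (a : Vertex n) (S : Vertex n → Bool) →
  sumV (λ v → ⟦ does (a ≟V v) ∧ S v ⟧) ≡ ⟦ S a ⟧
sumV-≟∧ a S = trans (sumV-at a off-a) (cong (λ b → ⟦ b ∧ S a ⟧) (dec-true (a ≟V a) refl))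
  where
  off-a : ∀ v → v ≢ a → ⟦ does (a ≟V v) ∧ S v ⟧ ≡ 0
  off-a v v≢a = cong (λ b → ⟦ b ∧ S v ⟧) (dec-false (a ≟V v) (v≢a ∘ sym))

sumV-≟W∧ : ∀ {n} (x : Word n) (S : Word n → Word n → Bool) →
  sumV (λ (x' , y') → ⟦ does (x ≟W x') ∧ S x' y' ⟧) ≡ sumW (λ y → ⟦ S x y ⟧)
sumV-≟W∧ x S = trans (sumV-within x off-x) (sumW-cong on-x)
  where
  off-x : ∀ x' y' → x' ≢ x → ⟦ does (x ≟W x') ∧ S x' y' ⟧ ≡ 0
  off-x x' y' x'≢x = cong (λ b → ⟦ b ∧ S x' y' ⟧) (dec-false (x ≟W x') (x'≢x ∘ sym))
  on-x : ∀ y → ⟦ does (x ≟W x) ∧ S x y ⟧ ≡ ⟦ S x y ⟧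
  on-x y = cong (λ b → ⟦ b ∧ S x y ⟧) (dec-true (x ≟W x) refl)

_∈V?_ : ∀ {n} (v : Vertex n) (l : List (Vertex n)) → Dec (v ∈ l)
v ∈V? l = mem? _≟V_ v l

∈-∷-count : ∀ {n} {a : Vertex n} {l} → ¬ a ∈ l → ∀ v →
  ⟦ does (v ∈V? (a ∷ l)) ⟧ ≡ ⟦ does (v ≟V a) ⟧ + ⟦ does (v ∈V? l) ⟧
∈-∷-count {a = a} {l} a∉l v with v ≟V a | v ∈V? l
... | yes refl | yes v∈l = contradiction v∈l a∉l
... | yes refl | no _    = refl
... | no _     | yes _   = refl
... | no _     | no _    = refl

length≡sumV-∈ : ∀ {n} {l : List (Vertex n)} → Unique l →
  length l ≡ sumV (λ v → ⟦ does (v ∈V? l) ⟧)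
length≡sumV-∈ {n} [] = sym (sumV-zero {n} (λ _ → refl))
length≡sumV-∈ {l = a ∷ l} (a∉l ∷ unique) = begin
  suc (length l)
    ≡⟨ cong₂ _+_ (sym one) (length≡sumV-∈ unique) ⟩
  sumV (λ v → ⟦ does (v ≟V a) ⟧) + sumV (λ v → ⟦ does (v ∈V? l) ⟧)
    ≡⟨ sumV-distrib-+ (λ v → ⟦ does (v ≟V a) ⟧) (λ v → ⟦ does (v ∈V? l) ⟧) ⟨
  sumV (λ v → ⟦ does (v ≟V a) ⟧ + ⟦ does (v ∈V? l) ⟧)
    ≡⟨ sumV-cong (∈-∷-count (All¬⇒¬Any a∉l)) ⟨
  sumV (λ v → ⟦ does (v ∈V? (a ∷ l)) ⟧) ∎
  where
  open ≡-Reasoning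
  one : sumV (λ v → ⟦ does (v ≟V a) ⟧) ≡ 1
  one = trans (sumV-at a (λ v v≢a → cong ⟦_⟧ (dec-false (v ≟V a) v≢a)))
              (cong ⟦_⟧ (dec-true (a ≟V a) refl))

-- Vertex sets in the hypercube Q_n

cubeAdj : ∀ {n} → Word n → Word n → Bool
cubeAdj []          []           = false
cubeAdj (false ∷ y) (false ∷ y') = cubeAdj y y'
cubeAdj (true  ∷ y) (true  ∷ y') = cubeAdj y y'
cubeAdj (false ∷ y) (true  ∷ y') = does (y ≟W y')
cubeAdj (true  ∷ y) (false ∷ y') = does (y ≟W y')

cubeAdj-flipBit : ∀ {n} (i : Fin n) (y : Word n) → T (cubeAdj y (flipBit i y))
cubeAdj-flipBit fzero    (false ∷ y) = T-does⁺ (y ≟W y) refl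
cubeAdj-flipBit fzero    (true ∷ y)  = T-does⁺ (y ≟W y) refl
cubeAdj-flipBit (fsuc i) (false ∷ y) = cubeAdj-flipBit i y
cubeAdj-flipBit (fsuc i) (true ∷ y)  = cubeAdj-flipBit i y

card : ∀ {n} → (Word n → Bool) → ℕ
card S = sumW (λ y → ⟦ S y ⟧)

degIn : ∀ {n} → (Word n → Bool) → Word n → ℕ
degIn S y = sumW (λ y' → ⟦ cubeAdj y y' ∧ S y' ⟧)

half : ∀ {n} → Bool → (Word (suc n) → Bool) → Word n → Bool
half b S y = S (b ∷ y)

T⇒1≤card : ∀ {n} (S : Word n → Bool) {y} → T (S y) → 1 ≤ card S
T⇒1≤card S {y} s = ≤-trans (T⇒1≤⟦⟧ s) (term≤sumW (λ y → ⟦ S y ⟧) y)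

card≡0⇒⟦⟧≡0 : ∀ {n} {S : Word n → Bool} → card S ≡ 0 → ∀ y → ⟦ S y ⟧ ≡ 0
card≡0⇒⟦⟧≡0 {S = S} empty y =
  n≤0⇒n≡0 (subst (⟦ S y ⟧ ≤_) empty (term≤sumW (λ y → ⟦ S y ⟧) y))

degIn-∷ : ∀ {n} (S : Word (suc n) → Bool) b y →
  degIn S (b ∷ y) ≡ ⟦ S (not b ∷ y) ⟧ + degIn (half b S) y
degIn-∷ S false y = trans (cong (degIn (half false S) y +_) (sumW-≟∧ y (half true S)))
                          (+-comm (degIn (half false S) y) _)
degIn-∷ S true  y = cong (_+ degIn (half true S) y) (sumW-≟∧ y (half false S))

2^δ≤card : ∀ {n} g (S : Word n → Bool) → 1 ≤ card S →
  (∀ y → T (S y) → g ≤ degIn S y) → 2 ^ g ≤ card S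
2^δ≤card zero S nonempty _ = nonempty
2^δ≤card {zero} (suc g) S nonempty δ with () ← δ [] (1≤⟦⟧⇒T nonempty)
2^δ≤card {suc n} (suc g) S nonempty δ =
  by-halves (card (half false S) ≟ 0) (card (half true S) ≟ 0)
  where
  δ-half : ∀ b y → T (half b S y) → suc g ≤ ⟦ S (not b ∷ y) ⟧ + degIn (half b S) y
  δ-half b y s = subst (suc g ≤_) (degIn-∷ S b y) (δ (b ∷ y) s)

  only-half : ∀ b → card (half (not b) S) ≡ 0 → card S ≡ card (half b S) → 2 ^ suc g ≤ card S
  only-half b empty split = subst (2 ^ suc g ≤_) (sym split)
    (2^δ≤card (suc g) (half b S) (subst (1 ≤_) split nonempty) δ')
    where
    δ' : ∀ y → T (half b S y) → suc g ≤ degIn (half b S) y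
    δ' y s = subst (λ k → suc g ≤ k + degIn (half b S) y) (card≡0⇒⟦⟧≡0 empty y) (δ-half b y s)

  2^g≤half : ∀ b → card (half b S) ≢ 0 → 2 ^ g ≤ card (half b S)
  2^g≤half b nonempty-b = 2^δ≤card g (half b S) (n≢0⇒n>0 nonempty-b)
    (λ y s → suc≤⟦⟧+⇒≤ (S (not b ∷ y)) (δ-half b y s))

  by-halves : Dec (card (half false S) ≡ 0) → Dec (card (half true S) ≡ 0) → 2 ^ suc g ≤ card S
  by-halves (yes empty₀) _ = only-half true empty₀ (cong (_+ card (half true S)) empty₀)
  by-halves (no _) (yes empty₁) =
    only-half false empty₁ (trans (cong (card (half false S) +_) empty₁) (+-identityʳ _))
  by-halves (no ne₀) (no ne₁) = 2^[1+g]≤+ g (2^g≤half false ne₀) (2^g≤half true ne₁)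

compl-involutive : ∀ {n} (x : Word n) → compl (compl x) ≡ x
compl-involutive x = begin
  compl (compl x)   ≡⟨ map-∘ not not x ⟨
  map (not ∘ not) x ≡⟨ map-cong not-involutive x ⟩
  map id x          ≡⟨ map-id x ⟩
  x ∎
  where open ≡-Reasoning

compl≢ : ∀ {n} (x : Word (suc n)) → compl x ≢ x
compl≢ (false ∷ _) ()
compl≢ (true ∷ _)  ()

flipBit-involutive : ∀ {n} (i : Fin n) (y : Word n) → flipBit i (flipBit i y) ≡ y
flipBit-involutive i y =
  trans (updateAt-updateAt-local i y (not-involutive (lookup y i))) (updateAt-id i y)

HCNAdj-sym : ∀ {n} {u v : Vertex n} → HCNAdj u v → HCNAdj v u
HCNAdj-sym (inj₁ (refl , i , refl)) = inj₁ (refl , i , sym (flipBit-involutive i _))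
HCNAdj-sym (inj₂ (inj₁ (x≢y , refl , refl))) = inj₂ (inj₁ (x≢y ∘ sym , refl , refl))
HCNAdj-sym {u = x , _} (inj₂ (inj₂ (refl , refl , refl))) =
  inj₂ (inj₂ (refl , sym (compl-involutive x) , sym (compl-involutive x)))

external : ∀ {n} → Vertex n → Vertex n
external (x , y) with x ≟W y
... | yes _ = compl x , compl y
... | no _  = y , x

external-leaves-cluster : ∀ {n} (x y : Word (suc n)) → proj₁ (external (x , y)) ≢ x
external-leaves-cluster x y with x ≟W y
... | yes _   = compl≢ x
... | no x≢y  = x≢y ∘ sym

HCNAdj⇒cube⊎external : ∀ {n} {x y x' y' : Word n} → HCNAdj (x , y) (x' , y') →
  (x' ≡ x × T (cubeAdj y y')) ⊎ (x' , y') ≡ external (x , y)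
HCNAdj⇒cube⊎external {y = y} (inj₁ (refl , i , refl)) = inj₁ (refl , cubeAdj-flipBit i y)
HCNAdj⇒cube⊎external {x = x} {y} (inj₂ (inj₁ (x≢y , refl , refl))) with x ≟W y
... | yes x≡y = contradiction x≡y x≢y
... | no _    = inj₂ refl
HCNAdj⇒cube⊎external {x = x} (inj₂ (inj₂ (refl , refl , refl))) with x ≟W x
... | yes _   = inj₂ refl
... | no x≢x  = contradiction refl x≢x

-- Clusters of a subgraph of HCN_n

module _ {n : ℕ} (X : Subgraph n) where
  open Subgraph X

  isVertex : Vertex n → Bool
  isVertex v = does (v ∈V? verts)

  cluster : Word n → Word n → Bool
  cluster x y = isVertex (x , y)

  order≡sumW-card-cluster : orderX X ≡ sumW (λ x → card (cluster x))
  order≡sumW-card-cluster = length≡sumV-∈ verts-nodup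

  card-cluster≤order : ∀ x → card (cluster x) ≤ orderX X
  card-cluster≤order x =
    ≤-trans (term≤sumW (card ∘ cluster) x) (≤-reflexive (sym order≡sumW-card-cluster))

  card-cluster+card-cluster≤order : ∀ {x₀ x₁} → x₀ ≢ x₁ →
    card (cluster x₀) + card (cluster x₁) ≤ orderX X
  card-cluster+card-cluster≤order x₀≢x₁ =
    ≤-trans (term+term≤sumW (card ∘ cluster) x₀≢x₁) (≤-reflexive (sym order≡sumW-card-cluster))

  EdgeX⇒HCNAdj : ∀ {u v} → EdgeX X u v → HCNAdj u v
  EdgeX⇒HCNAdj = [ edge-adj , HCNAdj-sym ∘ edge-adj ]

  degX≤external+degIn : ∀ x y →
    degX X (x , y) ≤ ⟦ isVertex (external (x , y)) ⟧ + degIn (cluster x) y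
  degX≤external+degIn x y = begin
    degX X (x , y)                         ≡⟨ length≡sumV-∈ (filter⁺ (EdgeX? X (x , y)) verts-nodup) ⟩
    sumV (λ v → ⟦ does (v ∈V? N) ⟧)         ≤⟨ sumV-mono-≤ neighbour≤ ⟩
    sumV (λ v → isExternal v + inCube v)   ≡⟨ sumV-distrib-+ isExternal inCube ⟩
    sumV isExternal + sumV inCube          ≡⟨ cong₂ _+_ (sumV-≟∧ e isVertex)
                                                        (sumV-≟W∧ x (λ x' y' → cubeAdj y y' ∧ cluster x' y')) ⟩
    ⟦ isVertex e ⟧ + degIn (cluster x) y   ∎
    where
    open ≤-Reasoning
    N = filter (EdgeX? X (x , y)) verts
    e = external (x , y)

    isExternal inCube : Vertex n → ℕ
    isExternal v     = ⟦ does (e ≟V v) ∧ isVertex v ⟧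
    inCube (x' , y') = ⟦ does (x ≟W x') ∧ cubeAdj y y' ∧ cluster x' y' ⟧

    neighbour≤ : ∀ v → ⟦ does (v ∈V? N) ⟧ ≤ isExternal v + inCube v
    neighbour≤ v with v ∈V? N
    ... | no _ = z≤n
    ... | yes v∈N = let v∈X , edge = ∈-filter⁻ (EdgeX? X (x , y)) v∈N in
                    by-kind v v∈X (HCNAdj⇒cube⊎external (EdgeX⇒HCNAdj edge))
      where
      by-kind : ∀ v → v ∈ verts → (proj₁ v ≡ x × T (cubeAdj y (proj₂ v))) ⊎ v ≡ e →
                1 ≤ isExternal v + inCube v
      by-kind (x' , y') v∈X (inj₁ (refl , adj)) = ≤-trans
        (T⇒1≤⟦⟧ (from T-∧ (T-does⁺ (x ≟W x) refl ,
                           from T-∧ (adj , T-does⁺ ((x , y') ∈V? verts) v∈X))))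
        (m≤n+m _ _)
      by-kind v v∈X (inj₂ refl) = ≤-trans
        (T⇒1≤⟦⟧ (from T-∧ (T-does⁺ (e ≟V e) refl , T-does⁺ (e ∈V? verts) v∈X)))
        (m≤m+n _ _)

  δ-cluster : ∀ {g} → MinDegreeAtLeast X g → ∀ {x y} → (x , y) ∈ verts →
    g ≤ ⟦ isVertex (external (x , y)) ⟧ + degIn (cluster x) y
  δ-cluster δ {x} {y} u = ≤-trans (δ u) (degX≤external+degIn x y)

  2^δ≤card-cluster : ∀ g {x y} → (x , y) ∈ verts →
    (∀ {y'} → (x , y') ∈ verts → g ≤ degIn (cluster x) y') → 2 ^ g ≤ card (cluster x)
  2^δ≤card-cluster g {x} {y} u δ =
    2^δ≤card g (cluster x) (T⇒1≤card (cluster x) (T-does⁺ ((x , y) ∈V? verts) u))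
      (λ y' s → δ (T-does⁻ ((x , y') ∈V? verts) s))

  two-clusters : ∀ {g x₀ y₀ x₁ y₁} → MinDegreeAtLeast X (suc g) →
    (x₀ , y₀) ∈ verts → (x₁ , y₁) ∈ verts → x₀ ≢ x₁ → 2 ^ suc g ≤ orderX X
  two-clusters {g} δ u₀ u₁ x₀≢x₁ =
    ≤-trans (2^[1+g]≤+ g (2^g≤card-cluster u₀) (2^g≤card-cluster u₁))
            (card-cluster+card-cluster≤order x₀≢x₁)
    where
    2^g≤card-cluster : ∀ {x y} → (x , y) ∈ verts → 2 ^ g ≤ card (cluster x)
    2^g≤card-cluster u = 2^δ≤card-cluster g u (λ u' → suc≤⟦⟧+⇒≤ _ (δ-cluster δ u'))

module _ {m : ℕ} (X : Subgraph (suc m)) where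
  open Subgraph X

  one-cluster : ∀ {g x y} → MinDegreeAtLeast X g → (x , y) ∈ verts →
    All (λ v → proj₁ v ≡ x) verts → 2 ^ g ≤ orderX X
  one-cluster {g} {x} δ u inside =
    ≤-trans (2^δ≤card-cluster X g u δ-inside) (card-cluster≤order X x)
    where
    δ-inside : ∀ {y'} → (x , y') ∈ verts → g ≤ degIn (cluster X x) y'
    δ-inside {y'} u' = subst (λ k → g ≤ k + degIn (cluster X x) y') no-external (δ-cluster X δ u')
      where
      no-external : ⟦ isVertex X (external (x , y')) ⟧ ≡ 0
      no-external = cong ⟦_⟧ (dec-false (external (x , y') ∈V? verts)
        (external-leaves-cluster x y' ∘ All.lookup inside))

1≤length⇒∃∈ : ∀ {A : Set} {l : List A} → 1 ≤ length l → ∃[ a ] a ∈ l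
1≤length⇒∃∈ {l = a ∷ _} _ = a , here refl

lemma4 : (n g : ℕ) → 2 ≤ n → 1 ≤ g → g ≤ n ∸ 1 →
    (X : Subgraph n) → 1 ≤ orderX X → MinDegreeAtLeast X g → 2 ^ g ≤ orderX X
lemma4 zero _ () _ _ _ _ _
lemma4 (suc m) zero _ _ _ X 1≤order _ = 1≤order
lemma4 (suc m) (suc g) _ _ _ X 1≤order δ
  with (x₀ , y₀) , u₀ ← 1≤length⇒∃∈ {l = Subgraph.verts X} 1≤order
  with all? (λ v → proj₁ v ≟W x₀) (Subgraph.verts X)
... | yes inside = one-cluster X δ u₀ inside
... | no ¬inside
  with (x₁ , y₁) , u₁ , x₁≢x₀ ← find (¬All⇒Any¬ (λ v → proj₁ v ≟W x₀) _ ¬inside)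
  = two-clusters X δ u₀ u₁ (x₁≢x₀ ∘ sym)
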